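{- Let $n,m\in\mathbb N$ satisfy $1\le m\le n/18$. Let $T$ be an $n$-vertex tree with bipartition classes $V_1$ and $V_2$, where $|V_2|\ge|V_1|/3$. Then $T$ contains a subtree $T'$ with $|T'|\le 10^4m$ such that $T'$ contains at least $m$ vertices of $V_2$, and at most one vertex of $V(T')\cap V_2$ has a neighbour in $T$ outside $V(T')$. -}

module Defs where

open import Data.Nat using (ℕ; zero; suc; _≤_; _+_)
open import Data.Fin using (Fin; zero; suc)
open import Data.Bool using (Bool; true; false; _∧_; not)
open import Data.List using (List; []; _∷_; filter; length; allFin)
open import Data.Product using (Σ; ∃; _×_; _,_)
open import Data.Empty using (⊥)
open import Relation.Binary.PropositionalEquality using (_≡_; _≢_)
open import Relation.Nullary using (¬_)
open import Relation.Nullary.Decidable using (does)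
open import Data.Bool.Properties using (_≟_)

record Graph (n : ℕ) : Set where
  field
    adj      : Fin n → Fin n → Bool
    adj-sym  : ∀ u v → adj u v ≡ adj v u
    adj-irr  : ∀ v → adj v v ≡ false
open Graph public

VSet : ℕ → Set
VSet n = Fin n → Bool

card : ∀ {n} → VSet n → ℕ
card {n} S = length (filter (λ v → S v ≟ true) (allFin n))

_∩_ : ∀ {n} → VSet n → VSet n → VSet n
(S ∩ T) v = S v ∧ T v

data WalkIn {n} (G : Graph n) (S : VSet n) : Fin n → Fin n → Set where
  here : ∀ {u} → S u ≡ true → WalkIn G S u u
  step : ∀ {u w v} → S u ≡ true → adj G u w ≡ true → WalkIn G S w v → WalkIn G S u v

ConnectedIn : ∀ {n} → Graph n → VSet n → Set
ConnectedIn G S = (∃ λ v → S v ≡ true) × (∀ u v → S u ≡ true → S v ≡ true → WalkIn G S u v)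

Connected : ∀ {n} → Graph n → Set
Connected G = ConnectedIn G (λ _ → true)

data Cycle-of {n} (G : Graph n) : Set where
  cycle : (k : ℕ) (c : Fin (suc (suc (suc k))) → Fin n)
        → (∀ i j → c i ≡ c j → i ≡ j)
        → (∀ (i : Fin (suc (suc k))) → adj G (c (Data.Fin.inject₁ i)) (c (suc i)) ≡ true)
        → adj G (c (Data.Fin.fromℕ (suc (suc k)))) (c zero) ≡ true
        → Cycle-of G

Acyclic : ∀ {n} → Graph n → Set
Acyclic G = ¬ Cycle-of G

IsTree : ∀ {n} → Graph n → Set
IsTree G = Connected G × Acyclic G

-- A proper 2-colouring: the bipartition (V₁ = colour false, V₂ = colour true).
IsBipartition : ∀ {n} → Graph n → (Fin n → Bool) → Set
IsBipartition G c = ∀ u v → adj G u v ≡ true → c u ≢ c v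

V₂ : ∀ {n} → (Fin n → Bool) → VSet n
V₂ c = c

V₁ : ∀ {n} → (Fin n → Bool) → VSet n
V₁ c v = not (c v)

HasOutsideNeighbour : ∀ {n} → Graph n → VSet n → Fin n → Set
HasOutsideNeighbour G S v = ∃ λ w → adj G v w ≡ true × S w ≡ false

{-# OPTIONS --safe #-}

-- Root T by breadth-first search; since T is acyclic and bipartite, every edge joins a
-- vertex to its parent.  Call v heavy in a rooted subtree W if W ∩ subtree v contains at
-- least m vertices of V₂, and let v be heavy with no heavy proper descendant.  Let X be v
-- together with the W-subtrees of some children of v, added one child at a time until
-- m ≤ |X ∩ V₂| < 2m (or all of W ∩ subtree v, if v ∈ V₂ and it has fewer than 3m vertices
-- of V₂).  X is connected and every vertex of X ∩ V₂ other than v has all its neighbours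
-- in X, so if |X| ≤ 8|X ∩ V₂| ≤ 24m we are done.  Otherwise X, or X − v when v stays, has
-- fewer than one V₂-vertex in eight: remove it from W and repeat.  A vertex of V₂ loses
-- children only as such a v, and it keeps m vertices of V₂ below it, so it can never lie
-- strictly inside a later X.  As the removed vertices are sparse in V₂, W always keeps m
-- of them: otherwise |V₂| < m + n/8, and n ≤ 4|V₂| would give n < 8m ≤ 18m ≤ n.

module Submission where

open import Defs
open import Data.Nat using (ℕ; zero; suc; _+_; _*_; _^_; _∸_; _≤_; _<_; _≤?_; _<?_; z≤n; s≤s; z<s; pred)
open import Data.Nat.Properties
open import Data.Nat.Induction using (<-wellFounded)
open import Data.Fin using (Fin; toℕ) renaming (_≟_ to _≟ᶠ_)
open import Data.Fin.Properties using (any?; toℕ-injective; toℕ<n; toℕ-inject₁; toℕ-fromℕ)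
open import Data.Bool using (Bool; true; false; _∧_; not)
open import Data.Bool.Properties using (∧-comm; ¬-not)
import Data.Bool.Properties as Bool
open import Data.List using (List; []; _∷_; filter; length; allFin)
open import Data.List.Properties using (length-filter; filter-some; filter-none; filter-all; length-tabulate)
import Data.List.Relation.Unary.All as All
open import Data.List.Relation.Unary.All.Properties using (all-filter)
open import Data.List.Relation.Unary.Unique.Propositional using (Unique)
open import Data.List.Relation.Unary.Unique.Propositional.Properties
  using (allFin⁺) renaming (filter⁺ to unique-filter⁺)
import Data.List.Relation.Unary.AllPairs as AllPairs
open import Data.List.Relation.Binary.Sublist.Propositional using (⊆-refl)
open import Data.List.Relation.Binary.Sublist.Propositional.Properties using (filter⁺; length-mono-≤)
open import Data.List.Membership.Propositional using (lose)
open import Data.List.Membership.Propositional.Properties using (∈-allFin; ∈-filter⁺)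
open import Data.List.Extrema.Nat using (argmax; argmax-all; f[xs]≤f[argmax])
open import Data.Product using (Σ; ∃; _×_; _,_; proj₁; proj₂)
open import Data.Sum using (_⊎_; inj₁; inj₂; fromInj₂)
open import Data.Empty using (⊥; ⊥-elim)
open import Function using (_∘_)
import Induction.WellFounded as WF
open import Relation.Binary.Construct.On using (wellFounded)
open import Relation.Binary.Definitions using (tri<; tri≈; tri>)
open import Relation.Nullary using (¬_; Dec; yes; no; does)
open import Relation.Nullary.Decidable using (dec-true; dec-false; _×-dec_; _⊎-dec_)
open import Relation.Binary.PropositionalEquality hiding (J)

least : ∀ {P : ℕ → Set} → (∀ k → Dec (P k)) → ∀ {N} → P N →
        ∃ λ k → P k × (∀ {i} → i < k → ¬ P i)
least P? {zero} p = zero , p , λ ()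
least P? {suc N} p with P? zero
... | yes p₀ = zero , p₀ , λ ()
... | no ¬p₀ with least (P? ∘ suc) p
...   | k , pk , below = suc k , pk , λ { {zero} _ → ¬p₀ ; {suc i} (s≤s i<k) → below i<k }

first-crossing : ∀ {m b} (f : ℕ → ℕ) → f 0 < b → (∀ {j} → f j < m → f (suc j) < b) →
                 ∀ {N} → m ≤ f N → ∃ λ j → m ≤ f j × f j < b
first-crossing {m} {b} f f0<b grow {N} m≤fN = fromInj₂ (λ fN<m → ⊥-elim (<⇒≱ fN<m m≤fN)) (scan N)
  where
  scan : ∀ N → f N < m ⊎ ∃ λ j → m ≤ f j × f j < b
  scan zero with m ≤? f 0
  ... | yes m≤f0 = inj₂ (0 , m≤f0 , f0<b)
  ... | no  m≰f0 = inj₁ (≰⇒> m≰f0)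
  scan (suc N) with scan N
  ... | inj₂ found = inj₂ found
  ... | inj₁ fN<m with m ≤? f (suc N)
  ...   | yes m≤f = inj₂ (suc N , m≤f , grow fN<m)
  ...   | no  m≰f = inj₁ (≰⇒> m≰f)

remaining-heavy : ∀ {m a r x} → 3 * m ≤ a + r → suc r ≤ x → x < 2 * m → m ≤ a
remaining-heavy {m} {a} 3m≤a+r r<x x<2m =
  +-cancelʳ-≤ (2 * m) m a (≤-trans 3m≤a+r (+-monoʳ-≤ a (<⇒≤ (<-trans r<x x<2m))))

too-light : ∀ {n m v₁ v₂ a b k} → n ≤ v₂ + v₁ → v₁ ≤ 3 * v₂ → v₂ ≤ a + b → a < m →
            8 * b ≤ k → k ≤ n → 18 * m ≤ n → ⊥
too-light {n} {m} {v₁} {v₂} {a} {b} n≤v₂+v₁ v₁≤3v₂ v₂≤a+b a<m 8b≤k k≤n 18m≤n =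
  <-irrefl refl (begin-strict
  18 * m  ≤⟨ 18m≤n ⟩
  n       ≤⟨ +-cancelʳ-≤ n n (8 * a) 2n≤8a+n ⟩
  8 * a   <⟨ *-monoʳ-< 8 a<m ⟩
  8 * m   ≤⟨ *-monoˡ-≤ m (m≤m+n 8 10) ⟩
  18 * m  ∎)
  where
  open ≤-Reasoning
  2n≤8a+n : n + n ≤ 8 * a + n
  2n≤8a+n = begin
    n + n              ≡⟨ cong (n +_) (sym (+-identityʳ n)) ⟩
    2 * n              ≤⟨ *-monoʳ-≤ 2 (≤-trans n≤v₂+v₁ (+-monoʳ-≤ v₂ v₁≤3v₂)) ⟩
    2 * (4 * v₂)       ≡⟨ *-assoc 2 4 v₂ ⟨
    8 * v₂             ≤⟨ *-monoʳ-≤ 8 v₂≤a+b ⟩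
    8 * (a + b)        ≡⟨ *-distribˡ-+ 8 a b ⟩
    8 * a + 8 * b      ≤⟨ +-monoʳ-≤ (8 * a) (≤-trans 8b≤k k≤n) ⟩
    8 * a + n          ∎

-- Vertex sets and their sizes

true≢false : true ≢ false
true≢false ()

does-true : ∀ {A : Set} (a? : Dec A) → does a? ≡ true → A
does-true (yes a) _ = a

∧-true⁺ : ∀ {a b} → a ≡ true → b ≡ true → a ∧ b ≡ true
∧-true⁺ refl refl = refl

∧-true⁻ : ∀ {a b} → a ∧ b ≡ true → a ≡ true × b ≡ true
∧-true⁻ {true} {true} _ = refl , refl

∧-not-true⁺ : ∀ {a b} → a ≡ true → b ≡ false → a ∧ not b ≡ true
∧-not-true⁺ refl refl = refl

∧-not-true⁻ : ∀ {a b} → a ∧ not b ≡ true → a ≡ true × b ≡ false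
∧-not-true⁻ {true} {false} _ = refl , refl

∧-swapʳ : ∀ a b c → (a ∧ b) ∧ c ≡ (a ∧ c) ∧ b
∧-swapʳ true  b c = ∧-comm b c
∧-swapʳ false b c = refl

module _ {n : ℕ} where

  infix 4 _⊆_
  _⊆_ : VSet n → VSet n → Set
  S ⊆ T = ∀ u → S u ≡ true → T u ≡ true

  ∁ : VSet n → VSet n
  ∁ S u = not (S u)

  _∖_ : VSet n → VSet n → VSet n
  S ∖ T = S ∩ ∁ T

  ｛_｝ : Fin n → VSet n
  ｛ v ｝ u = does (u ≟ᶠ v)

  ∈-｛｝ : ∀ {u v} → ｛ v ｝ u ≡ true → u ≡ v
  ∈-｛｝ {u} {v} = does-true (u ≟ᶠ v)

  ∉-｛｝ : ∀ {u v} → u ≢ v → ｛ v ｝ u ≡ false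
  ∉-｛｝ {u} {v} = dec-false (u ≟ᶠ v)

  ∩-⊆ˡ : ∀ S T → S ∩ T ⊆ S
  ∩-⊆ˡ S T u h = proj₁ (∧-true⁻ {S u} h)

  ∩-⊆ʳ : ∀ S T → S ∩ T ⊆ T
  ∩-⊆ʳ S T u h = proj₂ (∧-true⁻ {S u} h)

  ∩-swapʳ : ∀ S U X → (S ∩ U) ∩ X ⊆ (S ∩ X) ∩ U
  ∩-swapʳ S U X u = subst (_≡ true) (∧-swapʳ (S u) (U u) (X u))

  ∩-monoˡ : ∀ {S S'} U → S ⊆ S' → S ∩ U ⊆ S' ∩ U
  ∩-monoˡ U S⊆S' u h with ∧-true⁻ h
  ... | s , t = ∧-true⁺ (S⊆S' u s) t

  private
    count : VSet n → List (Fin n) → ℕ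
    count S xs = length (filter (λ v → S v Bool.≟ true) xs)

    count-split : ∀ S T xs → count S xs ≡ count (S ∩ T) xs + count (S ∖ T) xs
    count-split S T [] = refl
    count-split S T (x ∷ xs) with S x | T x
    ... | false | _     = count-split S T xs
    ... | true  | true  = cong suc (count-split S T xs)
    ... | true  | false = trans (cong suc (count-split S T xs)) (sym (+-suc _ _))

  card-split : ∀ S T → card S ≡ card (S ∩ T) + card (S ∖ T)
  card-split S T = count-split S T (allFin n)

  card-mono : ∀ {S T} → S ⊆ T → card S ≤ card T
  card-mono {S} {T} S⊆T =
    length-mono-≤ (filter⁺ (λ v → S v Bool.≟ true) (λ v → T v Bool.≟ true)
                           (λ { {u} refl h → S⊆T u h }) (⊆-refl {x = allFin n}))

  card≤n : ∀ S → card S ≤ n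
  card≤n S = ≤-trans (length-filter (λ v → S v Bool.≟ true) (allFin n))
                     (≤-reflexive (length-tabulate {n = n} (λ i → i)))

  card-full : card {n} (λ _ → true) ≡ n
  card-full = trans
    (cong length (filter-all (λ v → true Bool.≟ true) (All.universal (λ _ → refl) (allFin n))))
    (length-tabulate {n = n} (λ i → i))

  card-empty : card {n} (λ _ → false) ≡ 0
  card-empty = cong length (filter-none (λ v → false Bool.≟ true) (All.universal (λ _ ()) (allFin n)))

  card-pos : ∀ {S u} → S u ≡ true → 0 < card S
  card-pos {S} {u} h =
    filter-some (λ v → S v Bool.≟ true) (lose {A = Fin n} {P = λ v → S v ≡ true} (∈-allFin u) h)

  card-witness : ∀ {S} → 0 < card S → ∃ λ u → S u ≡ true
  card-witness {S} =
    first (filter (λ v → S v Bool.≟ true) (allFin n)) (all-filter (λ v → S v Bool.≟ true) (allFin n))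
    where
    first : ∀ xs → All.All (λ u → S u ≡ true) xs → 0 < length xs → ∃ λ u → S u ≡ true
    first (u ∷ _) (h All.∷ _) _ = u , h

  card-⊆｛｝ : ∀ {S v} → S ⊆ ｛ v ｝ → card S ≤ 1
  card-⊆｛｝ {S} {v} S⊆v = at-most-one (unique-filter⁺ (λ u → S u Bool.≟ true) (allFin⁺ n))
    (All.map (λ {u} h → ∈-｛｝ (S⊆v u h)) (all-filter (λ u → S u Bool.≟ true) (allFin n)))
    where
    at-most-one : ∀ {xs} → Unique xs → All.All (_≡ v) xs → length xs ≤ 1
    at-most-one {[]}        _                            _                         = z≤n
    at-most-one {_ ∷ []}    _                            _                         = s≤s z≤n
    at-most-one {_ ∷ _ ∷ _} ((x≢y All.∷ _) AllPairs.∷ _) (refl All.∷ refl All.∷ _) =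
      ⊥-elim (x≢y refl)

  card-split-≤ : ∀ {S T A B} → S ∩ T ⊆ A → S ∖ T ⊆ B → card S ≤ card A + card B
  card-split-≤ {S} {T} ⊆A ⊆B =
    ≤-trans (≤-reflexive (card-split S T)) (+-mono-≤ (card-mono ⊆A) (card-mono ⊆B))

  card-split-≥ : ∀ {S T A B} → A ⊆ S ∩ T → B ⊆ S ∖ T → card A + card B ≤ card S
  card-split-≥ {S} {T} A⊆ B⊆ =
    ≤-trans (+-mono-≤ (card-mono A⊆) (card-mono B⊆)) (≤-reflexive (sym (card-split S T)))

  card-∖｛｝ : ∀ S v → card S ≤ 1 + card (S ∖ ｛ v ｝)
  card-∖｛｝ S v = ≤-trans
    (card-split-≤ {S = S} {T = ｛ v ｝} {A = ｛ v ｝} (∩-⊆ʳ S ｛ v ｝) (λ _ h → h))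
    (+-monoˡ-≤ (card (S ∖ ｛ v ｝)) (card-⊆｛｝ {S = ｛ v ｝} (λ _ h → h)))

module V₂Count {n} (c : Fin n → Bool) where

  card₂ : VSet n → ℕ
  card₂ S = card (S ∩ V₂ c)

  card₂-mono : ∀ {S S'} → S ⊆ S' → card₂ S ≤ card₂ S'
  card₂-mono S⊆S' = card-mono (∩-monoˡ (V₂ c) S⊆S')

  card₂-split-≤ : ∀ S T {A B} → S ∩ T ⊆ A → S ∖ T ⊆ B → card₂ S ≤ card₂ A + card₂ B
  card₂-split-≤ S T {A} {B} ⊆A ⊆B = card-split-≤ {S = S ∩ V₂ c} {T} {A ∩ V₂ c} {B ∩ V₂ c}
    (λ u h → ∩-monoˡ (V₂ c) ⊆A u (∩-swapʳ S (V₂ c) T u h))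
    (λ u h → ∩-monoˡ (V₂ c) ⊆B u (∩-swapʳ S (V₂ c) (∁ T) u h))

  card₂-split-≥ : ∀ S T {A B} → A ⊆ S ∩ T → B ⊆ S ∖ T → card₂ A + card₂ B ≤ card₂ S
  card₂-split-≥ S T {A} {B} A⊆ B⊆ = card-split-≥ {S = S ∩ V₂ c} {T} {A ∩ V₂ c} {B ∩ V₂ c}
    (λ u h → ∩-swapʳ S T (V₂ c) u (∩-monoˡ (V₂ c) A⊆ u h))
    (λ u h → ∩-swapʳ S (∁ T) (V₂ c) u (∩-monoˡ (V₂ c) B⊆ u h))

  card₂-∖｛｝ : ∀ {S v} → S v ≡ true → c v ≡ true → suc (card₂ (S ∖ ｛ v ｝)) ≤ card₂ S
  card₂-∖｛｝ {S} {v} v∈S cv = ≤-trans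
    (+-monoˡ-≤ (card₂ (S ∖ ｛ v ｝))
               (card-pos {S = ｛ v ｝ ∩ V₂ c} (∧-true⁺ (dec-true (v ≟ᶠ v) refl) cv)))
    (card₂-split-≥ S ｛ v ｝ {A = ｛ v ｝}
      (λ u u∈v → ∧-true⁺ (subst (λ z → S z ≡ true) (sym (∈-｛｝ u∈v)) v∈S) u∈v) (λ _ h → h))

  sparse-∖｛｝ : ∀ {S} v → 8 * card₂ S < card S → 8 * card₂ (S ∖ ｛ v ｝) ≤ card (S ∖ ｛ v ｝)
  sparse-∖｛｝ {S} v sparse = ≤-trans (*-monoʳ-≤ 8 (card₂-mono (∩-⊆ˡ S (∁ ｛ v ｝))))
                                   (≤-pred (<-≤-trans sparse (card-∖｛｝ S v)))

  card₂-∩-∖ : ∀ W R U → card₂ (W ∩ U) ≤ card₂ ((W ∖ R) ∩ U) + card₂ R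
  card₂-∩-∖ W R U = ≤-trans
    (card₂-split-≤ (W ∩ U) R {A = R} {B = (W ∖ R) ∩ U} (∩-⊆ʳ (W ∩ U) R) (∩-swapʳ W U (∁ R)))
    (≤-reflexive (+-comm (card₂ R) _))

module _ {n} {G : Graph n} {S : VSet n} where

  walk-snoc : ∀ {u v w} → WalkIn G S u v → adj G v w ≡ true → S w ≡ true → WalkIn G S u w
  walk-snoc (here s)     vw w∈S = step s vw (here w∈S)
  walk-snoc (step s a p) vw w∈S = step s a (walk-snoc p vw w∈S)

  walk-++ : ∀ {u v w} → WalkIn G S u v → WalkIn G S v w → WalkIn G S u w
  walk-++ (here _)     q = q
  walk-++ (step s a p) q = step s a (walk-++ p q)

  walk-reverse : ∀ {u v} → WalkIn G S u v → WalkIn G S v u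
  walk-reverse (here s)              = here s
  walk-reverse (step {u} {w} s uw p) = walk-snoc (walk-reverse p) (trans (adj-sym G w u) uw) s

cycle-of-ℕ : ∀ {n} {G : Graph n} (k : ℕ) (f : ℕ → Fin n) →
             (∀ {i j} → i ≤ suc (suc k) → j ≤ suc (suc k) → f i ≡ f j → i ≡ j) →
             (∀ {i} → i ≤ suc k → adj G (f i) (f (suc i)) ≡ true) →
             adj G (f (suc (suc k))) (f 0) ≡ true →
             Cycle-of G
cycle-of-ℕ {G = G} k f injective path closing = cycle k (f ∘ toℕ)
  (λ i j fi≡fj → toℕ-injective (injective (≤-pred (toℕ<n i)) (≤-pred (toℕ<n j)) fi≡fj))
  (λ i → subst (λ t → adj G (f t) (f (suc (toℕ i))) ≡ true) (sym (toℕ-inject₁ i))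
               (path (≤-pred (toℕ<n i))))
  (subst (λ t → adj G (f t) (f 0) ≡ true) (sym (toℕ-fromℕ (suc (suc k)))) closing)

-- Shortest-path trees

record ShortestPathTree {n} (G : Graph n) : Set where
  field
    root         : Fin n
    parent       : Fin n → Fin n
    depth        : Fin n → ℕ
    parent-root  : parent root ≡ root
    depth-root   : depth root ≡ 0
    depth≡0⇒root : ∀ {u} → depth u ≡ 0 → u ≡ root
    depth-parent : ∀ {u} → u ≢ root → depth u ≡ suc (depth (parent u))
    parent-adj   : ∀ {u} → u ≢ root → adj G (parent u) u ≡ true
    depth-adj    : ∀ {u w} → adj G u w ≡ true → depth w ≤ suc (depth u)

module BreadthFirst {n} (G : Graph n) (r : Fin n) (reachable : ∀ u → WalkIn G (λ _ → true) r u) where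

  Within : ℕ → Fin n → Set
  Within zero    u = u ≡ r
  Within (suc k) u = Within k u ⊎ ∃ λ w → Within k w × adj G w u ≡ true

  within? : ∀ k u → Dec (Within k u)
  within? zero    u = u ≟ᶠ r
  within? (suc k) u = within? k u ⊎-dec any? (λ w → within? k w ×-dec (adj G w u Bool.≟ true))

  within-walk : ∀ {S k u v} → WalkIn G S u v → Within k u → ∃ λ j → Within j v
  within-walk (here _)     h = _ , h
  within-walk (step _ a p) h = within-walk p (inj₂ (_ , h , a))

  private
    distance : ∀ u → ∃ λ k → Within k u × (∀ {i} → i < k → ¬ Within i u)
    distance u = least (λ k → within? k u) (proj₂ (within-walk (reachable u) refl))

  depth : Fin n → ℕ
  depth u = proj₁ (distance u)

  depth-within : ∀ u → Within (depth u) u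
  depth-within u = proj₁ (proj₂ (distance u))

  depth-minimal : ∀ {k u} → Within k u → depth u ≤ k
  depth-minimal {k} {u} h = ≮⇒≥ λ k<d → proj₂ (proj₂ (distance u)) k<d h

  depth-adj : ∀ {u w} → adj G u w ≡ true → depth w ≤ suc (depth u)
  depth-adj {u} a = depth-minimal (inj₂ (u , depth-within u , a))

  ParentOf : Fin n → Fin n → Set
  ParentOf u w = adj G w u ≡ true × suc (depth w) ≡ depth u

  parent? : ∀ u → Dec (∃ (ParentOf u))
  parent? u = any? (λ w → (adj G w u Bool.≟ true) ×-dec (suc (depth w) ≟ depth u))

  parent : Fin n → Fin n
  parent u with parent? u
  ... | yes (w , _) = w
  ... | no _        = r

  has-parent : ∀ {u} → u ≢ r → ∃ (ParentOf u)
  has-parent {u} u≢r with depth u in d≡ | depth-within u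
  ... | zero  | u≡r               = ⊥-elim (u≢r u≡r)
  ... | suc k | inj₁ near         = ⊥-elim (1+n≰n (subst (_≤ k) d≡ (depth-minimal near)))
  ... | suc k | inj₂ (w , hw , a) =
    w , a , ≤-antisym (s≤s (depth-minimal hw)) (subst (_≤ suc (depth w)) d≡ (depth-adj a))

  parent-spec : ∀ {u} → u ≢ r → ParentOf u (parent u)
  parent-spec {u} u≢r with parent? u
  ... | yes (_ , p) = p
  ... | no ∄        = ⊥-elim (∄ (has-parent u≢r))

  depth-root : depth r ≡ 0
  depth-root = n≤0⇒n≡0 (depth-minimal {0} refl)

  parent-root : parent r ≡ r
  parent-root with parent? r
  ... | yes (_ , _ , d≡) = ⊥-elim (1+n≢0 (trans d≡ depth-root))
  ... | no _             = refl

  tree : ShortestPathTree G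
  tree = record
    { root         = r
    ; parent       = parent
    ; depth        = depth
    ; parent-root  = parent-root
    ; depth-root   = depth-root
    ; depth≡0⇒root = λ {u} d≡0 → subst (λ k → Within k u) d≡0 (depth-within u)
    ; depth-parent = λ u≢r → sym (proj₂ (parent-spec u≢r))
    ; parent-adj   = λ u≢r → proj₁ (parent-spec u≢r)
    ; depth-adj    = depth-adj
    }

-- Ancestors and subtrees

module Ancestry {n} {G : Graph n} (T : ShortestPathTree G) where
  open ShortestPathTree T

  adj-parent : ∀ {u} → u ≢ root → adj G u (parent u) ≡ true
  adj-parent {u} u≢r = trans (adj-sym G u (parent u)) (parent-adj u≢r)

  depth≡suc⇒≢root : ∀ {u k} → depth u ≡ suc k → u ≢ root
  depth≡suc⇒≢root du refl = 1+n≢0 (trans (sym du) depth-root)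

  parent^ : ℕ → Fin n → Fin n
  parent^ zero    u = u
  parent^ (suc k) u = parent^ k (parent u)

  depth-parent-pred : ∀ u → depth (parent u) ≡ pred (depth u)
  depth-parent-pred u with u ≟ᶠ root
  ... | yes refl = trans (cong depth parent-root) (trans depth-root (cong pred (sym depth-root)))
  ... | no u≢r   = cong pred (sym (depth-parent u≢r))

  depth-parent^ : ∀ k u → depth (parent^ k u) ≡ depth u ∸ k
  depth-parent^ zero    u = refl
  depth-parent^ (suc k) u = begin
    depth (parent^ k (parent u))  ≡⟨ depth-parent^ k (parent u) ⟩
    depth (parent u) ∸ k          ≡⟨ cong (_∸ k) (depth-parent-pred u) ⟩
    pred (depth u) ∸ k            ≡⟨ ∸-+-assoc (depth u) 1 k ⟩
    depth u ∸ suc k               ∎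
    where open ≡-Reasoning

  parent^-+ : ∀ j k u → parent^ (j + k) u ≡ parent^ k (parent^ j u)
  parent^-+ zero    k u = refl
  parent^-+ (suc j) k u = parent^-+ j k (parent u)

  parent^-suc : ∀ k u → parent^ (suc k) u ≡ parent (parent^ k u)
  parent^-suc k u = trans (cong (λ i → parent^ i u) (+-comm 1 k)) (parent^-+ k 1 u)

  parent^-root : ∀ k → parent^ k root ≡ root
  parent^-root zero    = refl
  parent^-root (suc k) = trans (cong (parent^ k) parent-root) (parent^-root k)

  parent^-depth : ∀ u → parent^ (depth u) u ≡ root
  parent^-depth u = depth≡0⇒root (trans (depth-parent^ (depth u) u) (n∸n≡0 (depth u)))

  parent^-beyond : ∀ {k u} → depth u ≤ k → parent^ k u ≡ root
  parent^-beyond {k} {u} d≤k = begin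
    parent^ k u                                  ≡⟨ cong (λ i → parent^ i u) (sym (m+[n∸m]≡n d≤k)) ⟩
    parent^ (depth u + (k ∸ depth u)) u          ≡⟨ parent^-+ (depth u) (k ∸ depth u) u ⟩
    parent^ (k ∸ depth u) (parent^ (depth u) u)  ≡⟨ cong (parent^ (k ∸ depth u)) (parent^-depth u) ⟩
    parent^ (k ∸ depth u) root                   ≡⟨ parent^-root (k ∸ depth u) ⟩
    root                                         ∎
    where open ≡-Reasoning

  subtree : Fin n → VSet n
  subtree v u = does (parent^ (depth u ∸ depth v) u ≟ᶠ v)

  subtree⁻ : ∀ {v u} → subtree v u ≡ true → parent^ (depth u ∸ depth v) u ≡ v
  subtree⁻ {v} {u} = does-true (parent^ (depth u ∸ depth v) u ≟ᶠ v)

  subtree⁺ : ∀ k {v u} → parent^ k u ≡ v → subtree v u ≡ true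
  subtree⁺ k {v} {u} refl with ≤-total k (depth u)
  ... | inj₁ k≤d = dec-true (_ ≟ᶠ _)
    (cong (λ i → parent^ i u) (trans (cong (depth u ∸_) (depth-parent^ k u)) (m∸[m∸n]≡n k≤d)))
  ... | inj₂ d≤k = dec-true (_ ≟ᶠ _) (begin
    parent^ (depth u ∸ depth (parent^ k u)) u  ≡⟨ cong (λ i → parent^ (depth u ∸ i) u) (depth-parent^ k u) ⟩
    parent^ (depth u ∸ (depth u ∸ k)) u        ≡⟨ cong (λ i → parent^ (depth u ∸ i) u) (m≤n⇒m∸n≡0 d≤k) ⟩
    parent^ (depth u) u                        ≡⟨ parent^-depth u ⟩
    root                                       ≡⟨ sym (parent^-beyond d≤k) ⟩
    parent^ k u                                ∎)
    where open ≡-Reasoning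

  subtree-refl : ∀ v → subtree v v ≡ true
  subtree-refl v = subtree⁺ 0 refl

  subtree-root : ∀ u → subtree root u ≡ true
  subtree-root u = subtree⁺ (depth u) (parent^-depth u)

  subtree-trans : ∀ {a b u} → subtree a b ≡ true → subtree b u ≡ true → subtree a u ≡ true
  subtree-trans {a} {b} {u} a≽b b≽u = subtree⁺ ((depth u ∸ depth b) + (depth b ∸ depth a))
    (trans (parent^-+ (depth u ∸ depth b) (depth b ∸ depth a) u)
           (trans (cong (parent^ (depth b ∸ depth a)) (subtree⁻ b≽u)) (subtree⁻ a≽b)))

  subtree-child : ∀ {v u} → subtree v (parent u) ≡ true → subtree v u ≡ true
  subtree-child {v} {u} h = subtree⁺ (suc (depth (parent u) ∸ depth v)) (subtree⁻ h)

  subtree-parent : ∀ {v u} → subtree v u ≡ true → u ≢ v → subtree v (parent u) ≡ true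
  subtree-parent {v} {u} h u≢v with depth u ∸ depth v | subtree⁻ h
  ... | zero  | u≡v = ⊥-elim (u≢v u≡v)
  ... | suc k | e   = subtree⁺ k e

  subtree-depth : ∀ {v u} → subtree v u ≡ true → depth v ≤ depth u
  subtree-depth {v} {u} h = subst (_≤ depth u)
    (trans (sym (depth-parent^ (depth u ∸ depth v) u)) (cong depth (subtree⁻ h)))
    (m∸n≤m (depth u) (depth u ∸ depth v))

  subtree-depth< : ∀ {v u} → subtree v u ≡ true → u ≢ v → depth v < depth u
  subtree-depth< {v} {u} h u≢v = ≤∧≢⇒< (subtree-depth h) λ dv≡du → u≢v (trans
    (cong (λ k → parent^ k u) (sym (trans (cong (depth u ∸_) dv≡du) (n∸n≡0 (depth u)))))
    (subtree⁻ h))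

  strictly-below⇒≢root : ∀ {v u} → subtree v u ≡ true → u ≢ v → u ≢ root
  strictly-below⇒≢root {v} h u≢v refl = n≮0 (subst (depth v <_) depth-root (subtree-depth< h u≢v))

  parent∉subtree : ∀ {v} → v ≢ root → subtree v (parent v) ≢ true
  parent∉subtree {v} v≢r h = 1+n≰n (subst (_≤ depth (parent v)) (depth-parent v≢r) (subtree-depth h))

  ancestor-unique : ∀ {a b u} → subtree a u ≡ true → subtree b u ≡ true → depth a ≡ depth b → a ≡ b
  ancestor-unique {a} {b} {u} a≽u b≽u da≡db =
    trans (sym (subtree⁻ a≽u)) (trans (cong (λ d → parent^ (depth u ∸ d) u) da≡db) (subtree⁻ b≽u))

  private
    shallower-ancestor : ∀ {a b u} → subtree a u ≡ true → subtree b u ≡ true → depth a ≤ depth b →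
                         subtree a b ≡ true
    shallower-ancestor {a} {b} {u} a≽u b≽u da≤db = subtree⁺ (depth b ∸ depth a) (ancestor-unique
      (subtree-trans (subtree⁺ (depth b ∸ depth a) refl) b≽u) a≽u
      (trans (depth-parent^ (depth b ∸ depth a) b) (m∸[m∸n]≡n da≤db)))

  ancestors-comparable : ∀ {a b u} → subtree a u ≡ true → subtree b u ≡ true →
                         subtree a b ≡ true ⊎ subtree b a ≡ true
  ancestors-comparable {a} {b} a≽u b≽u with ≤-total (depth a) (depth b)
  ... | inj₁ da≤db = inj₁ (shallower-ancestor a≽u b≽u da≤db)
  ... | inj₂ db≤da = inj₂ (shallower-ancestor b≽u a≽u db≤da)

  branch : Fin n → Fin n → Fin n
  branch v u = parent^ (depth u ∸ suc (depth v)) u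

  module _ {v u} (v≽u : subtree v u ≡ true) (u≢v : u ≢ v) where

    depth-branch : depth (branch v u) ≡ suc (depth v)
    depth-branch = trans (depth-parent^ (depth u ∸ suc (depth v)) u) (m∸[m∸n]≡n (subtree-depth< v≽u u≢v))

    parent-branch : parent (branch v u) ≡ v
    parent-branch = ancestor-unique
      (subtree⁺ (suc (depth u ∸ suc (depth v))) (parent^-suc (depth u ∸ suc (depth v)) u)) v≽u
      (trans (depth-parent-pred (branch v u)) (cong pred depth-branch))

    branch-below : subtree v (branch v u) ≡ true
    branch-below = subtree⁺ 1 parent-branch

    branch≢ : branch v u ≢ v
    branch≢ b≡v = 1+n≰n (≤-reflexive (trans (sym depth-branch) (cong depth b≡v)))

  subtree-branch : ∀ v u → subtree (branch v u) u ≡ true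
  subtree-branch v u = subtree⁺ (depth u ∸ suc (depth v)) refl

  branch-through : ∀ {v w u} → subtree v w ≡ true → w ≢ v → subtree w u ≡ true →
                   branch v u ≡ branch v w
  branch-through {v} {w} {u} v≽w w≢v w≽u =
    trans (cong (λ d → parent^ (depth u ∸ d) u) (sym (depth-branch v≽w w≢v)))
          (subtree⁻ (subtree-trans (subtree-branch v w) w≽u))

-- In a tree every edge is a parent edge

module TreeEdges {n} {G : Graph n} (T : ShortestPathTree G) where
  open ShortestPathTree T
  open Ancestry T

  module ClosedWalk {a b w : Fin n} {d j : ℕ}
      (da : depth a ≡ d) (db : depth b ≡ d) (dw : depth w ≡ suc d)
      (wa : adj G w a ≡ true) (wb : adj G w b ≡ true) (J≤d : suc j ≤ d)
      (meet : parent^ (suc j) a ≡ parent^ (suc j) b)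
      (apart : ∀ {i} → i ≤ j → parent^ i a ≢ parent^ i b) where

    J : ℕ
    J = suc j

    -- The closed walk w, a, parent a, …, parent^J a = parent^J b, …, parent b, b.
    vertex : ℕ → Fin n
    vertex zero = w
    vertex (suc p) with p ≤? J
    ... | yes _ = parent^ p a
    ... | no _  = parent^ (J + J ∸ p) b

    vertex-a : ∀ {p} → p ≤ J → vertex (suc p) ≡ parent^ p a
    vertex-a {p} p≤J with p ≤? J
    ... | yes _  = refl
    ... | no p≰J = ⊥-elim (p≰J p≤J)

    vertex-b : ∀ {p} → J < p → vertex (suc p) ≡ parent^ (J + J ∸ p) b
    vertex-b {p} J<p with p ≤? J
    ... | yes p≤J = ⊥-elim (<⇒≱ J<p p≤J)
    ... | no _    = refl

    depth-a : ∀ p → depth (parent^ p a) ≡ d ∸ p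
    depth-a p = trans (depth-parent^ p a) (cong (_∸ p) da)

    depth-b : ∀ p → depth (parent^ p b) ≡ d ∸ p
    depth-b p = trans (depth-parent^ p b) (cong (_∸ p) db)

    ≢root-below : ∀ {x p} → depth x ≡ d ∸ p → p < d → x ≢ root
    ≢root-below {x} {p} dx p<d with d ∸ p in d∸p≡
    ... | zero  = ⊥-elim (<⇒≢ (m<n⇒0<n∸m p<d) (sym d∸p≡))
    ... | suc _ = depth≡suc⇒≢root dx

    parent-step : ∀ {x y} → x ≢ root → y ≡ parent x → adj G x y ≡ true
    parent-step x≢r refl = adj-parent x≢r

    child-step : ∀ {x y} → y ≢ root → x ≡ parent y → adj G x y ≡ true
    child-step y≢r refl = parent-adj y≢r

    2J∸J+1≡j : J + J ∸ suc J ≡ j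
    2J∸J+1≡j = trans (cong (_∸ suc J) (+-suc J j)) (m+n∸m≡n J j)

    steps : ∀ {i} → i ≤ J + J → adj G (vertex i) (vertex (suc i)) ≡ true
    steps {zero} _ = subst (λ x → adj G w x ≡ true) (sym (vertex-a z≤n)) wa
    steps {suc p} p<2J with <-cmp p J
    ... | tri< p<J _ _ =
      subst₂ (λ x y → adj G x y ≡ true) (sym (vertex-a (<⇒≤ p<J))) (sym (vertex-a p<J))
        (parent-step (≢root-below (depth-a p) (<-≤-trans p<J J≤d)) (parent^-suc p a))
    ... | tri≈ _ refl _ =
      subst₂ (λ x y → adj G x y ≡ true) (sym (vertex-a ≤-refl))
        (sym (trans (vertex-b (n<1+n J)) (cong (λ t → parent^ t b) 2J∸J+1≡j)))
        (child-step (≢root-below (depth-b j) (<-≤-trans (n<1+n j) J≤d)) (trans meet (parent^-suc j b)))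
    ... | tri> _ _ J<p =
      subst₂ (λ x y → adj G x y ≡ true)
        (sym (trans (vertex-b J<p) (cong (λ s → parent^ s b) (+-∸-assoc 1 p<2J))))
        (sym (vertex-b (m<n⇒m<1+n J<p)))
        (child-step (≢root-below (depth-b t) t<d) (parent^-suc t b))
      where
      t = J + J ∸ suc p
      t<d : t < d
      t<d = ≤-<-trans (∸-monoʳ-≤ (J + J) (s≤s (<⇒≤ J<p))) (subst (_< d) (sym 2J∸J+1≡j) J≤d)

    closing : adj G (vertex (suc (J + J))) (vertex 0) ≡ true
    closing = subst (λ x → adj G x w ≡ true)
      (sym (trans (vertex-b (m<m+n J z<s)) (cong (λ t → parent^ t b) (n∸n≡0 (J + J)))))
      (trans (adj-sym G b w) wb)

    b-index<J : ∀ {p} → J < p → p ≤ J + J → J + J ∸ p < J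
    b-index<J {p} J<p p≤2J = subst (J + J ∸ p <_) (m+n∸n≡m J J) (∸-monoʳ-< J<p p≤2J)

    depth-vertex≤d : ∀ p → depth (vertex (suc p)) ≤ d
    depth-vertex≤d p with p ≤? J
    ... | yes _ = subst (_≤ d) (sym (depth-a p)) (m∸n≤m d p)
    ... | no _  = subst (_≤ d) (sym (depth-b (J + J ∸ p))) (m∸n≤m d (J + J ∸ p))

    a≢b-side : ∀ {p q} → p ≤ J → J < q → q ≤ J + J → parent^ p a ≢ parent^ (J + J ∸ q) b
    a≢b-side {p} {q} p≤J J<q q≤2J a≡b =
      apart (≤-pred (subst (_< J) (sym p≡t) t<J)) (trans a≡b (cong (λ i → parent^ i b) (sym p≡t)))
      where
      t<J = b-index<J J<q q≤2J
      p≡t : p ≡ J + J ∸ q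
      p≡t = ∸-cancelˡ-≡ (≤-trans p≤J J≤d) (≤-trans (<⇒≤ t<J) J≤d)
              (trans (sym (depth-a p)) (trans (cong depth a≡b) (depth-b (J + J ∸ q))))

    injective : ∀ {i i'} → i ≤ suc (J + J) → i' ≤ suc (J + J) → vertex i ≡ vertex i' → i ≡ i'
    injective {zero}  {zero}   _ _ _ = refl
    injective {zero}  {suc q}  _ _ e =
      ⊥-elim (1+n≰n (subst (_≤ d) (trans (cong depth (sym e)) dw) (depth-vertex≤d q)))
    injective {suc p} {zero}   _ _ e =
      ⊥-elim (1+n≰n (subst (_≤ d) (trans (cong depth e) dw) (depth-vertex≤d p)))
    injective {suc p} {suc q} (s≤s p≤2J) (s≤s q≤2J) e with p ≤? J | q ≤? J
    ... | yes p≤J | yes q≤J = cong suc (∸-cancelˡ-≡ (≤-trans p≤J J≤d) (≤-trans q≤J J≤d)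
            (trans (sym (depth-a p)) (trans (cong depth e) (depth-a q))))
    ... | no p≰J  | no q≰J  = cong suc (∸-cancelˡ-≡ p≤2J q≤2J (∸-cancelˡ-≡
            (≤-trans (<⇒≤ (b-index<J (≰⇒> p≰J) p≤2J)) J≤d)
            (≤-trans (<⇒≤ (b-index<J (≰⇒> q≰J) q≤2J)) J≤d)
            (trans (sym (depth-b (J + J ∸ p))) (trans (cong depth e) (depth-b (J + J ∸ q))))))
    ... | yes p≤J | no q≰J  = ⊥-elim (a≢b-side p≤J (≰⇒> q≰J) q≤2J e)
    ... | no p≰J  | yes q≤J = ⊥-elim (a≢b-side q≤J (≰⇒> p≰J) p≤2J (sym e))

    cycle-of-walk : Cycle-of G
    cycle-of-walk = cycle-of-ℕ (j + J) vertex injective steps closing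

  private
    ancestors-meet : ∀ {a b} → depth a ≡ depth b → parent^ (depth a) a ≡ parent^ (depth a) b
    ancestors-meet {a} {b} da≡db =
      trans (parent^-depth a) (sym (subst (λ k → parent^ k b ≡ root) (sym da≡db) (parent^-depth b)))

  common-child⇒cycle : ∀ {a b w} → a ≢ b → depth a ≡ depth b → depth w ≡ suc (depth a) →
                       adj G w a ≡ true → adj G w b ≡ true → Cycle-of G
  common-child⇒cycle {a} {b} a≢b da≡db dw wa wb
    with least (λ i → parent^ i a ≟ᶠ parent^ i b) {depth a} (ancestors-meet da≡db)
  ... | zero  , a≡b  , _     = ⊥-elim (a≢b a≡b)
  ... | suc j , meet , first = ClosedWalk.cycle-of-walk refl (sym da≡db) dw wa wb
    (≮⇒≥ λ d<J → first d<J (ancestors-meet da≡db)) meet (λ i≤j → first (s≤s i≤j))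

  module _ (acyclic : Acyclic G) {c : Fin n → Bool} (bipartite : IsBipartition G c) where

    colour-parent : ∀ {u} → u ≢ root → c u ≡ not (c (parent u))
    colour-parent u≢r = ¬-not (bipartite _ _ (adj-parent u≢r))

    same-depth⇒same-colour : ∀ k {u w} → depth u ≡ k → depth w ≡ k → c u ≡ c w
    same-depth⇒same-colour zero    du dw = cong c (trans (depth≡0⇒root du) (sym (depth≡0⇒root dw)))
    same-depth⇒same-colour (suc k) {u} {w} du dw =
      trans (colour-parent u≢r) (trans (cong not parents) (sym (colour-parent w≢r)))
      where
      u≢r = depth≡suc⇒≢root du
      w≢r = depth≡suc⇒≢root dw
      parents : c (parent u) ≡ c (parent w)
      parents = same-depth⇒same-colour k (suc-injective (trans (sym (depth-parent u≢r)) du))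
                                         (suc-injective (trans (sym (depth-parent w≢r)) dw))

    parent-of-deeper : ∀ {u w} → adj G u w ≡ true → depth w ≡ suc (depth u) → parent w ≡ u
    parent-of-deeper {u} {w} uw dw with parent w ≟ᶠ u
    ... | yes p≡u = p≡u
    ... | no  p≢u = ⊥-elim (acyclic (common-child⇒cycle p≢u
      (suc-injective (trans (sym (depth-parent w≢r)) dw)) (depth-parent w≢r)
      (adj-parent w≢r) (trans (adj-sym G w u) uw)))
      where w≢r = depth≡suc⇒≢root dw

    parent-edge : ∀ {u w} → adj G u w ≡ true →
                  (u ≢ root × parent u ≡ w) ⊎ (w ≢ root × parent w ≡ u)
    parent-edge {u} {w} uw with <-cmp (depth u) (depth w)
    ... | tri< du<dw _ _ = inj₂ (depth≡suc⇒≢root dw≡ , parent-of-deeper uw dw≡)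
      where dw≡ = ≤-antisym (depth-adj uw) du<dw
    ... | tri≈ _ du≡dw _ = ⊥-elim (bipartite u w uw (same-depth⇒same-colour (depth w) du≡dw refl))
    ... | tri> _ _ dw<du = inj₁ (depth≡suc⇒≢root du≡ , parent-of-deeper wu du≡)
      where wu = trans (adj-sym G w u) uw
            du≡ = ≤-antisym (depth-adj wu) dw<du

-- Peeling off branches that are sparse in V₂

module Peeling {n} {G : Graph n} (T : ShortestPathTree G) (acyclic : Acyclic G)
               {c : Fin n → Bool} (bipartite : IsBipartition G c) (m : ℕ) (1≤m : 1 ≤ m) where
  open ShortestPathTree T
  open Ancestry T
  open TreeEdges T
  open V₂Count c

  OneExit : VSet n → Set
  OneExit S = (u v : Fin n) → S u ≡ true → V₂ c u ≡ true → HasOutsideNeighbour G S u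
                           → S v ≡ true → V₂ c v ≡ true → HasOutsideNeighbour G S v
                           → u ≡ v

  Result : Set
  Result = Σ (VSet n) λ S → ConnectedIn G S × card S ≤ (10 ^ 4) * m × m ≤ card₂ S × OneExit S

  module Pendant (X : VSet n) (v : Fin n) (v∈X : X v ≡ true)
                 (X-up : ∀ {u} → X u ≡ true → u ≢ v → u ≢ root × X (parent u) ≡ true) where

    walk-up : ∀ k {u} → depth u ≡ k → X u ≡ true → WalkIn G X u v
    walk-up k {u} du u∈X with u ≟ᶠ v
    walk-up k       du u∈X | yes refl = here u∈X
    walk-up zero    du u∈X | no u≢v   = ⊥-elim (proj₁ (X-up u∈X u≢v) (depth≡0⇒root du))
    walk-up (suc k) du u∈X | no u≢v   = step u∈X (adj-parent u≢r)
      (walk-up k (suc-injective (trans (sym (depth-parent u≢r)) du)) p∈X)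
      where
      u≢r = proj₁ (X-up u∈X u≢v)
      p∈X = proj₂ (X-up u∈X u≢v)

    connected : ConnectedIn G X
    connected = (v , v∈X) , λ u w u∈X w∈X →
      walk-++ (walk-up _ refl u∈X) (walk-reverse (walk-up _ refl w∈X))

    one-exit : (∀ {u y} → X u ≡ true → c u ≡ true → u ≢ v → adj G u y ≡ true → X y ≡ true) →
               OneExit X
    one-exit closed u w u∈X cu u-exit w∈X cw w-exit =
      trans (exit⇒v u∈X cu u-exit) (sym (exit⇒v w∈X cw w-exit))
      where
      exit⇒v : ∀ {u} → X u ≡ true → c u ≡ true → HasOutsideNeighbour G X u → u ≡ v
      exit⇒v {u} u∈X cu (y , uy , y∉X) with u ≟ᶠ v
      ... | yes u≡v = u≡v
      ... | no  u≢v = ⊥-elim (true≢false (trans (sym (closed u∈X cu u≢v uy)) y∉X))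

  UpClosed : VSet n → Set
  UpClosed W = W ⊆ λ u → W (parent u)

  up-closed-parent^ : ∀ {W} → UpClosed W → ∀ k {u} → W u ≡ true → W (parent^ k u) ≡ true
  up-closed-parent^ up zero    u∈W = u∈W
  up-closed-parent^ up (suc k) u∈W = up-closed-parent^ up k (up _ u∈W)

  Heavy : VSet n → Fin n → Set
  Heavy W v = m ≤ card₂ (W ∩ subtree v)

  MinimalHeavy : VSet n → Fin n → Set
  MinimalHeavy W v =
    W v ≡ true × Heavy W v × (∀ {y} → W y ≡ true → subtree v y ≡ true → y ≢ v → ¬ Heavy W y)

  KeepsChildren : VSet n → Set
  KeepsChildren W = ∀ {x} → W x ≡ true → c x ≡ true →
                    (∀ {y} → y ≢ root → parent y ≡ x → W y ≡ true) ⊎ MinimalHeavy W x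

  record Admissible (W : VSet n) : Set where
    field
      up-closed      : UpClosed W
      keeps-children : KeepsChildren W
      sparse-outside : 8 * card₂ (∁ W) ≤ card (∁ W)

  module Prefixes {W : VSet n} (up : UpClosed W) {v : Fin n} where

    InPrefix : ℕ → Fin n → Set
    InPrefix j u = u ≡ v ⊎ toℕ (branch v u) < j

    -- v and the part in W of the subtrees of the children of v with index below j;
    -- going from j to j + 1 adds at most one such subtree, which is light (`layer-light`).
    prefix : ℕ → VSet n
    prefix j = W ∩ (subtree v ∩ λ u → does ((u ≟ᶠ v) ⊎-dec (toℕ (branch v u) <? j)))

    prefix⁺ : ∀ {j u} → W u ≡ true → subtree v u ≡ true → InPrefix j u → prefix j u ≡ true
    prefix⁺ {j} {u} u∈W v≽u i =
      ∧-true⁺ u∈W (∧-true⁺ v≽u (dec-true ((u ≟ᶠ v) ⊎-dec (toℕ (branch v u) <? j)) i))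

    prefix⁻ : ∀ {j u} → prefix j u ≡ true → W u ≡ true × subtree v u ≡ true × InPrefix j u
    prefix⁻ {j} {u} h with ∧-true⁻ h
    ... | u∈W , h′ with ∧-true⁻ h′
    ...   | v≽u , i = u∈W , v≽u , does-true ((u ≟ᶠ v) ⊎-dec (toℕ (branch v u) <? j)) i

    prefix-v : ∀ {j} → W v ≡ true → prefix j v ≡ true
    prefix-v {j} v∈W = prefix⁺ {j} v∈W (subtree-refl v) (inj₁ refl)

    prefix-⊆ : ∀ {j} → prefix j ⊆ W ∩ subtree v
    prefix-⊆ {j} u h with prefix⁻ {j} {u} h
    ... | u∈W , v≽u , _ = ∧-true⁺ u∈W v≽u

    subtree-⊆-prefix : W ∩ subtree v ⊆ prefix n
    subtree-⊆-prefix u h with ∧-true⁻ h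
    ... | u∈W , v≽u = prefix⁺ {n} u∈W v≽u (inj₂ (toℕ<n (branch v u)))

    prefix-zero : prefix 0 ⊆ ｛ v ｝
    prefix-zero u h with prefix⁻ {0} {u} h
    ... | _ , _ , inj₁ u≡v = dec-true (u ≟ᶠ v) u≡v
    ... | _ , _ , inj₂ ()

    prefix-up : ∀ {j u} → prefix j u ≡ true → u ≢ v → u ≢ root × prefix j (parent u) ≡ true
    prefix-up {j} {u} h u≢v with prefix⁻ {j} {u} h
    ... | _   , _   , inj₁ u≡v = ⊥-elim (u≢v u≡v)
    ... | u∈W , v≽u , inj₂ b<j =
      strictly-below⇒≢root v≽u u≢v , prefix⁺ {j} (up u u∈W) v≽p in-prefix
      where
      v≽p = subtree-parent v≽u u≢v
      in-prefix : InPrefix j (parent u)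
      in-prefix with parent u ≟ᶠ v
      ... | yes p≡v = inj₁ p≡v
      ... | no  p≢v = inj₂ (subst (λ b → toℕ b < j) (branch-through v≽p p≢v (subtree⁺ 1 refl)) b<j)

    prefix-child : ∀ {j u y} → prefix j u ≡ true → u ≢ v → parent y ≡ u → W y ≡ true →
                   prefix j y ≡ true
    prefix-child {j} {u} {y} h u≢v refl y∈W with prefix⁻ {j} {u} h
    ... | _ , v≽u , inj₁ u≡v = ⊥-elim (u≢v u≡v)
    ... | _ , v≽u , inj₂ b<j = prefix⁺ {j} y∈W (subtree-child v≽u)
      (inj₂ (subst (λ b → toℕ b < j) (sym (branch-through v≽u u≢v (subtree⁺ 1 refl))) b<j))

    prefix-all-children : ∀ {u} → W u ≡ true → prefix n (parent u) ≡ true → prefix n u ≡ true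
    prefix-all-children {u} u∈W p∈X =
      subtree-⊆-prefix u
        (∧-true⁺ u∈W (subtree-child (∩-⊆ʳ W (subtree v) (parent u) (prefix-⊆ {n} _ p∈X))))

    trimmed-children : ∀ {j u} → u ≢ root → W u ≡ true → (prefix j ∖ ｛ v ｝) (parent u) ≡ true →
                       (prefix j ∖ ｛ v ｝) u ≡ true
    trimmed-children {j} {u} u≢r u∈W p∈R with ∧-not-true⁻ p∈R
    ... | p∈X , p∉v = ∧-not-true⁺ (prefix-child {j} p∈X p≢v refl u∈W) (∉-｛｝ u≢v)
      where
      p≢v : parent u ≢ v
      p≢v p≡v = true≢false (trans (sym (dec-true (parent u ≟ᶠ v) p≡v)) p∉v)
      u≢v : u ≢ v
      u≢v refl = parent∉subtree u≢r (∩-⊆ʳ W (subtree v) (parent v) (prefix-⊆ {j} (parent v) p∈X))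

    trimmed-parents : ∀ {j y} → (prefix j ∖ ｛ v ｝) y ≡ true → y ≢ v → parent y ≢ v →
                      (prefix j ∖ ｛ v ｝) (parent y) ≡ true
    trimmed-parents {j} y∈R y≢v p≢v =
      ∧-not-true⁺ (proj₂ (prefix-up {j} (proj₁ (∧-not-true⁻ y∈R)) y≢v)) (∉-｛｝ p≢v)

    v∉trimmed : ∀ {j} → (prefix j ∖ ｛ v ｝) v ≢ true
    v∉trimmed {j} v∈R =
      true≢false (trans (sym (dec-true (v ≟ᶠ v) refl)) (proj₂ (∧-not-true⁻ {prefix j v} v∈R)))

    layer : ℕ → VSet n
    layer j = prefix (suc j) ∖ prefix j

    layer⁻ : ∀ {j u} → W v ≡ true → layer j u ≡ true →
             W u ≡ true × subtree v u ≡ true × u ≢ v × toℕ (branch v u) ≡ j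
    layer⁻ {j} {u} v∈W h with ∧-not-true⁻ h
    ... | new , not-old with prefix⁻ {suc j} {u} new
    ...   | _ , _ , inj₁ refl = ⊥-elim (true≢false (trans (sym (prefix-v {j} v∈W)) not-old))
    ...   | u∈W , v≽u , inj₂ b<1+j =
      u∈W , v≽u , (λ { refl → true≢false (trans (sym (prefix-v {j} v∈W)) not-old) }) ,
      ≤-antisym (≤-pred b<1+j)
                (≮⇒≥ λ b<j → true≢false (trans (sym (prefix⁺ {j} u∈W v≽u (inj₂ b<j))) not-old))

    module _ (minimal : MinimalHeavy W v) where
      private
        v∈W = proj₁ minimal
        light-below = proj₂ (proj₂ minimal)

      layer-light : ∀ j → card₂ (layer j) < m
      layer-light j with 0 <? card₂ (layer j)
      ... | no  empty = ≤-<-trans (≮⇒≥ empty) 1≤m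
      ... | yes nonempty with card-witness nonempty
      ...   | x , x∈ with layer⁻ v∈W (proj₁ (∧-true⁻ x∈))
      ...     | x∈W , v≽x , x≢v , bx≡j =
        ≤-<-trans (card₂-mono layer⊆)
                  (≰⇒> (light-below b∈W (branch-below v≽x x≢v) (branch≢ v≽x x≢v)))
        where
        b = branch v x
        b∈W : W b ≡ true
        b∈W = up-closed-parent^ up (depth x ∸ suc (depth v)) x∈W
        layer⊆ : layer j ⊆ W ∩ subtree b
        layer⊆ u h with layer⁻ v∈W h
        ... | u∈W , _ , _ , bu≡j = ∧-true⁺ u∈W
          (subst (λ z → subtree z u ≡ true) (toℕ-injective (trans bu≡j (sym bx≡j))) (subtree-branch v u))

      prefix-crossing : ∃ λ j → m ≤ card₂ (prefix j) × card₂ (prefix j) < 2 * m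
      prefix-crossing = first-crossing (λ j → card₂ (prefix j)) start grow {n} heavy-all
        where
        start : card₂ (prefix 0) < 2 * m
        start = ≤-<-trans (card-⊆｛｝ (λ u h → prefix-zero u (proj₁ (∧-true⁻ h))))
                          (*-monoʳ-≤ 2 1≤m)
        grow : ∀ {j} → card₂ (prefix j) < m → card₂ (prefix (suc j)) < 2 * m
        grow {j} small = ≤-<-trans
          (card₂-split-≤ (prefix (suc j)) (prefix j) {prefix j} {layer j}
                         (∩-⊆ʳ (prefix (suc j)) (prefix j)) (λ u h → h))
          (<-≤-trans (+-mono-< small (layer-light j)) (≤-reflexive (cong (m +_) (sym (+-identityʳ m)))))
        heavy-all : m ≤ card₂ (prefix n)
        heavy-all = ≤-trans (proj₁ (proj₂ minimal)) (card₂-mono subtree-⊆-prefix)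

      prefix-closed : KeepsChildren W → ∀ {j u y} → prefix j u ≡ true → c u ≡ true → u ≢ v →
                      adj G u y ≡ true → prefix j y ≡ true
      prefix-closed keeps {j} {u} {y} h cu u≢v uy with prefix⁻ {j} {u} h | parent-edge acyclic bipartite uy
      ... | _   , _   , _ | inj₁ (_ , p≡y) =
        subst (λ z → prefix j z ≡ true) p≡y (proj₂ (prefix-up {j} h u≢v))
      ... | u∈W , v≽u , _ | inj₂ (y≢r , p≡u) with keeps u∈W cu
      ...   | inj₁ children        = prefix-child {j} h u≢v p≡u (children y≢r p≡u)
      ...   | inj₂ (_ , heavy-u , _) = ⊥-elim (light-below u∈W v≽u u≢v heavy-u)

      emit : KeepsChildren W → ∀ j → m ≤ card₂ (prefix j) → card₂ (prefix j) ≤ 3 * m →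
             card (prefix j) ≤ 8 * card₂ (prefix j) → Result
      emit keeps j heavy ≤3m dense = prefix j , connected , size , heavy , one-exit (prefix-closed keeps {j})
        where
        open Pendant (prefix j) v (prefix-v {j} v∈W) (prefix-up {j})
        size : card (prefix j) ≤ 10 ^ 4 * m
        size = begin
          card (prefix j)         ≤⟨ dense ⟩
          8 * card₂ (prefix j)    ≤⟨ *-monoʳ-≤ 8 ≤3m ⟩
          8 * (3 * m)             ≡⟨ *-assoc 8 3 m ⟨
          24 * m                  ≤⟨ *-monoˡ-≤ m (m≤m+n 24 9976) ⟩
          10 ^ 4 * m              ∎
          where open ≤-Reasoning

  module Removal {W : VSet n} (adm : Admissible W) {v : Fin n} (minimal : MinimalHeavy W v) (R : VSet n)
    (R⊆subtree : R ⊆ W ∩ subtree v)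
    (R-children : ∀ {u} → u ≢ root → W u ≡ true → R (parent u) ≡ true → R u ≡ true)
    (R-parents : ∀ {y} → R y ≡ true → y ≢ v → parent y ≢ v → R (parent y) ≡ true)
    (v∈R⇒V₂ : R v ≡ true → c v ≡ true)
    (v-stays-heavy : R v ≡ false → c v ≡ true → Heavy (W ∖ R) v)
    (R-sparse : 8 * card₂ R ≤ card R)
    (R-nonempty : 0 < card R) where
    open Admissible adm

    private
      W′ = W ∖ R
      v∈W = proj₁ minimal
      light-below = proj₂ (proj₂ minimal)

      R⊆W : R ⊆ W
      R⊆W u h = ∩-⊆ˡ W (subtree v) u (R⊆subtree u h)

      W′⊆W : W′ ⊆ W
      W′⊆W = ∩-⊆ˡ W (∁ R)

      heavy-shrinks : ∀ {y} → Heavy W′ y → Heavy W y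
      heavy-shrinks h = ≤-trans h (card₂-mono (∩-monoˡ (subtree _) W′⊆W))

    smaller : card W′ < card W
    smaller = <-≤-trans (m<n+m (card W′) R-nonempty)
      (card-split-≥ {S = W} {T = R} {A = R} {B = W′} (λ u h → ∧-true⁺ (R⊆W u h) h) (λ u h → h))

    up-closed′ : UpClosed W′
    up-closed′ u h with ∧-not-true⁻ h
    ... | u∈W , u∉R = ∧-not-true⁺ (up-closed u u∈W) p∉R
      where
      p∉R : R (parent u) ≡ false
      p∉R with R (parent u) in p∈R | u ≟ᶠ root
      ... | false | _        = refl
      ... | true  | yes refl =
        ⊥-elim (true≢false (trans (sym (subst (λ z → R z ≡ true) parent-root p∈R)) u∉R))
      ... | true  | no u≢r   = ⊥-elim (true≢false (trans (sym (R-children u≢r u∈W p∈R)) u∉R))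

    light-persists : ∀ {x} → (∀ {y} → W y ≡ true → subtree x y ≡ true → y ≢ x → ¬ Heavy W y) →
                     ∀ {y} → W′ y ≡ true → subtree x y ≡ true → y ≢ x → ¬ Heavy W′ y
    light-persists light y∈W′ x≽y y≢x = light (W′⊆W _ y∈W′) x≽y y≢x ∘ heavy-shrinks

    child-kept : ∀ {x y} → R x ≡ false → c x ≡ true → x ≢ v → y ≢ root → parent y ≡ x →
                 R y ≡ false
    child-kept {x} {y} x∉R cx x≢v y≢r refl with R y in y∈R | y ≟ᶠ v
    ... | false | _        = refl
    ... | true  | yes refl = ⊥-elim (bipartite x v (parent-adj y≢r) (trans cx (sym (v∈R⇒V₂ y∈R))))
    ... | true  | no y≢v   = ⊥-elim (true≢false (trans (sym (R-parents y∈R y≢v x≢v)) x∉R))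

    subtree-kept : ∀ {x} → W x ≡ true → MinimalHeavy W x → x ≢ v → W ∩ subtree x ⊆ W′ ∩ subtree x
    subtree-kept {x} x∈W (_ , heavy-x , light-x) x≢v u h with ∧-true⁻ h
    ... | u∈W , x≽u = ∧-true⁺ (∧-not-true⁺ u∈W u∉R) x≽u
      where
      u∉R : R u ≡ false
      u∉R with R u in u∈R
      ... | false = refl
      ... | true with ancestors-comparable x≽u (∩-⊆ʳ W (subtree v) u (R⊆subtree u u∈R))
      ...   | inj₁ x≽v = ⊥-elim (light-x v∈W x≽v (x≢v ∘ sym) (proj₁ (proj₂ minimal)))
      ...   | inj₂ v≽x = ⊥-elim (light-below x∈W v≽x x≢v heavy-x)

    keeps-children′ : KeepsChildren W′
    keeps-children′ {x} x∈W′ cx with ∧-not-true⁻ x∈W′ | x ≟ᶠ v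
    ... | _   , x∉R | yes refl = inj₂ (x∈W′ , v-stays-heavy x∉R cx , light-persists light-below)
    ... | x∈W , x∉R | no x≢v with keeps-children x∈W cx
    ...   | inj₁ children =
      inj₁ λ y≢r py≡x → ∧-not-true⁺ (children y≢r py≡x) (child-kept x∉R cx x≢v y≢r py≡x)
    ...   | inj₂ mh@(_ , heavy-x , light-x) =
      inj₂ (x∈W′ , ≤-trans heavy-x (card₂-mono (subtree-kept x∈W mh x≢v)) , light-persists light-x)

    sparse-outside′ : 8 * card₂ (∁ W′) ≤ card (∁ W′)
    sparse-outside′ = begin
      8 * card₂ (∁ W′)
        ≤⟨ *-monoʳ-≤ 8 (card₂-split-≤ (∁ W′) R (∩-⊆ʳ (∁ W′) R) outside-R⊆outside-W) ⟩
      8 * (card₂ R + card₂ (∁ W))         ≡⟨ *-distribˡ-+ 8 (card₂ R) (card₂ (∁ W)) ⟩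
      8 * card₂ R + 8 * card₂ (∁ W)       ≤⟨ +-mono-≤ R-sparse sparse-outside ⟩
      card R + card (∁ W)
        ≤⟨ card-split-≥ {S = ∁ W′} {T = R} R⊆outside outside-W⊆outside-R ⟩
      card (∁ W′)                         ∎
      where
      open ≤-Reasoning
      outside-R⊆outside-W : ∁ W′ ∖ R ⊆ ∁ W
      outside-R⊆outside-W u h with W u | R u
      ... | false | _     = refl
      ... | true  | true  = h
      ... | true  | false = h
      R⊆outside : R ⊆ ∁ W′ ∩ R
      R⊆outside u h rewrite h with W u
      ... | true  = refl
      ... | false = refl
      outside-W⊆outside-R : ∁ W ⊆ ∁ W′ ∖ R
      outside-W⊆outside-R u h with W u in u∈W | R u in u∈R
      ... | false | false = refl
      ... | false | true  = ⊥-elim (true≢false (trans (sym (R⊆W u u∈R)) u∈W))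

    admissible′ : Admissible W′
    admissible′ = record
      { up-closed      = up-closed′
      ; keeps-children = keeps-children′
      ; sparse-outside = sparse-outside′
      }

  minimal-heavy : ∀ {W} → UpClosed W → m ≤ card₂ W → ∃ (MinimalHeavy W)
  minimal-heavy {W} up heavy = v , proj₁ v-heavy , proj₂ v-heavy , λ y∈W v≽y y≢v heavy-y →
    <⇒≱ (subtree-depth< v≽y y≢v) (deepest y∈W heavy-y)
    where
    heavy? : ∀ u → Dec (W u ≡ true × Heavy W u)
    heavy? u = (W u Bool.≟ true) ×-dec (m ≤? card₂ (W ∩ subtree u))

    root∈W : W root ≡ true
    root∈W with card-witness (≤-trans 1≤m heavy)
    ... | u , h =
      subst (λ z → W z ≡ true) (parent^-depth u) (up-closed-parent^ up (depth u) (∩-⊆ˡ W (V₂ c) u h))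

    root-heavy : Heavy W root
    root-heavy = ≤-trans heavy (card₂-mono (λ u h → ∧-true⁺ h (subtree-root u)))

    candidates = filter heavy? (allFin n)
    v = argmax depth root candidates

    v-heavy : W v ≡ true × Heavy W v
    v-heavy = argmax-all depth {P = λ u → W u ≡ true × Heavy W u} (root∈W , root-heavy)
                         (all-filter heavy? (allFin n))

    deepest : ∀ {y} → W y ≡ true → Heavy W y → depth y ≤ depth v
    deepest {y} y∈W heavy-y =
      All.lookup (f[xs]≤f[argmax] root candidates) (∈-filter⁺ heavy? (∈-allFin y) (y∈W , heavy-y))

  module Step {W : VSet n} (adm : Admissible W) {v : Fin n} (minimal : MinimalHeavy W v)
              (recurse : ∀ {W′} → card W′ < card W → Admissible W′ → Result) where
    open Admissible adm
    open Prefixes up-closed {v}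

    private
      v∈W = proj₁ minimal

    whole-subtree : c v ≡ true → card₂ (W ∩ subtree v) < 3 * m → Result
    whole-subtree cv light with card (prefix n) ≤? 8 * card₂ (prefix n)
    ... | yes dense = emit minimal keeps-children n
                           (≤-trans (proj₁ (proj₂ minimal)) (card₂-mono subtree-⊆-prefix))
                           (≤-trans (card₂-mono (prefix-⊆ {n})) (<⇒≤ light)) dense
    ... | no  sparse = recurse smaller admissible′
      where
      open Removal adm minimal (prefix n) (prefix-⊆ {n}) (λ _ → prefix-all-children)
        (λ y∈X y≢v _ → proj₂ (prefix-up {n} y∈X y≢v)) (λ _ → cv)
        (λ v∉X → ⊥-elim (true≢false (trans (sym (prefix-v {n} v∈W)) v∉X)))
        (<⇒≤ (≰⇒> sparse)) (card-pos {S = prefix n} (prefix-v {n} v∈W))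

    branches : (c v ≡ true → 3 * m ≤ card₂ (W ∩ subtree v)) → Result
    branches heavy-if-V₂ with prefix-crossing minimal
    ... | j , heavy , light with card (prefix j) ≤? 8 * card₂ (prefix j)
    ...   | yes dense =
      emit minimal keeps-children j heavy (≤-trans (<⇒≤ light) (*-monoˡ-≤ m (m≤m+n 2 1))) dense
    ...   | no  sparse = recurse smaller admissible′
      where
      X R : VSet n
      X = prefix j
      R = X ∖ ｛ v ｝

      R-nonempty : 0 < card R
      R-nonempty = ≤-trans (s≤s z≤n)
        (≤-trans (*-monoʳ-≤ 8 (≤-trans 1≤m heavy))
                 (≤-pred (<-≤-trans (≰⇒> sparse) (card-∖｛｝ X v))))

      v-stays-heavy : R v ≡ false → c v ≡ true → Heavy (W ∖ R) v
      v-stays-heavy _ cv = remaining-heavy (≤-trans (heavy-if-V₂ cv) (card₂-∩-∖ W R (subtree v)))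
                                           (card₂-∖｛｝ (prefix-v {j} v∈W) cv) light

      open Removal adm minimal R (λ u h → prefix-⊆ {j} u (∩-⊆ˡ X (∁ ｛ v ｝) u h))
        (trimmed-children {j}) (trimmed-parents {j}) (⊥-elim ∘ v∉trimmed {j})
        v-stays-heavy (sparse-∖｛｝ v (≰⇒> sparse)) R-nonempty

    result : Result
    result with c v in cv | card₂ (W ∩ subtree v) <? 3 * m
    ... | true  | yes light = whole-subtree cv light
    ... | true  | no  heavy = branches (λ _ → ≮⇒≥ heavy)
    ... | false | _         = branches (λ cv≡true → ⊥-elim (true≢false (trans (sym cv≡true) cv)))

  full-admissible : Admissible (λ _ → true)
  full-admissible = record
    { up-closed      = λ _ _ → refl
    ; keeps-children = λ _ _ → inj₁ λ _ _ → refl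
    ; sparse-outside = subst (λ k → 8 * k ≤ k) (sym (card-empty {n})) z≤n
    }

  module _ (V₁≤3V₂ : card (V₁ c) ≤ 3 * card (V₂ c)) (18m≤n : 18 * m ≤ n) where

    heavy-if-sparse-outside : ∀ {W} → 8 * card₂ (∁ W) ≤ card (∁ W) → m ≤ card₂ W
    heavy-if-sparse-outside {W} sparse with m ≤? card₂ W
    ... | yes heavy = heavy
    ... | no  light =
      ⊥-elim (too-light n≤V₂+V₁ V₁≤3V₂ V₂≤ (≰⇒> light) sparse (card≤n (∁ W)) 18m≤n)
      where
      n≤V₂+V₁ : n ≤ card (V₂ c) + card (V₁ c)
      n≤V₂+V₁ = ≤-reflexive (trans (sym card-full) (card-split (λ _ → true) c))
      V₂≤ : card (V₂ c) ≤ card₂ W + card₂ (∁ W)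
      V₂≤ = card₂-split-≤ (λ _ → true) W (∩-⊆ʳ (λ _ → true) W) (∩-⊆ʳ (λ _ → true) (∁ W))

    peel : ∀ W → Admissible W → Result
    peel = WF.All.wfRec (wellFounded card <-wellFounded) _ (λ W → Admissible W → Result) peel-step
      where
      peel-step : ∀ W → (∀ {W′} → card W′ < card W → Admissible W′ → Result) →
                  Admissible W → Result
      peel-step W recurse adm = Step.result adm (proj₂ v-minimal) recurse
        where
        open Admissible adm
        v-minimal = minimal-heavy up-closed (heavy-if-sparse-outside sparse-outside)

proposition6p4 : (n m : ℕ) → 1 ≤ m → 18 * m ≤ n
               → (T : Graph n) → IsTree T
               → (c : Fin n → Bool) → IsBipartition T c
               → card (V₁ c) ≤ 3 * card (V₂ c)
               → Σ (VSet n) λ S →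
                   ConnectedIn T S
                   × card S ≤ (10 ^ 4) * m
                   × m ≤ card (S ∩ V₂ c)
                   × ((u v : Fin n) → S u ≡ true → V₂ c u ≡ true → HasOutsideNeighbour T S u
                                    → S v ≡ true → V₂ c v ≡ true → HasOutsideNeighbour T S v
                                    → u ≡ v)
proposition6p4 n m 1≤m 18m≤n T (connected , acyclic) c bipartite V₁≤3V₂ =
  peel V₁≤3V₂ 18m≤n (λ _ → true) full-admissible
  where
  r = proj₁ (proj₁ connected)
  open Peeling (BreadthFirst.tree T r (λ u → proj₂ connected r u refl refl)) acyclic bipartite m 1≤m
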